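{- DN and EDML are equally expressive: for every DN formula there is an equivalent EDML formula, and for every EDML formula there is an equivalent DN formula.
   Context: Graphs are finite, simple, vertex-colored (unary relation symbols $\mathbf P$ interpreted as subsets $\mathbf P(G)\subseteq V(G)$). $N^r(v)=\{u\ne v:\mathrm{dist}_G(u,v)\le r\}$; $N^r_d(U)=\{v:|N^r(v)\cap U|\ge d\}$ for $d,r\in\mathbb N^+$. DN logic: existential MSO over graphs (quantification over vertices and vertex sets; atomic $E(x,y)$, $x=y$, $x\in X$, $\mathbf P(x)$; only existential quantifiers; negation only of quantifier-free formulas) extended by size measurements $|t|=m,|t|\le m,|t|\ge m$ ($m\in\mathbb N$) and comparisons $t_1=t_2$, $t_1\subseteq t_2$, $t_1\supseteq t_2$ of neighborhood terms, which are built from set variables, unary relation symbols and $\emptyset$ by complement, $\cap$, $\cup$, $\setminus$ and $N^r_d(\cdot)$, and denote vertex sets in the obvious way. EDML (existential distance modal logic): every set variable $X$ and every unary relation symbol $\mathbf P$ is an unfinished inner formula; if $\psi$ is unfinished and $d,r\in\mathbb N^+$ then $\square^r_d\psi$ is unfinished and $\rangle\square_d\psi$ is a finished inner formula; $|X|\le m$ and $|X|\ge m$ ($X$ a set variable, $m\in\mathbb N$) are finished; negations and conjunctions of unfinished (resp. finished) formulas are unfinished (resp. finished); EDML formulas are finished inner formulas and formulas $\exists X\,\psi$ with $\psi$ a finished inner formula or an EDML formula ($X$ a set variable). Semantics under an assignment $\beta$ of vertex sets to set variables: unfinished formulas are evaluated at an active vertex $v$; $X$ holds at $v$ iff $v\in\beta(X)$;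 $\mathbf P$ holds at $v$ iff $v\in\mathbf P(G)$; $\square^r_d\psi$ holds at $v$ iff at least $d$ vertices $w\in N^r(v)$ satisfy $\psi$ at $w$; $\rangle\square_d\psi$ holds iff at least $d$ vertices $v\in V(G)$ satisfy $\psi$ at $v$; size measurements, Boolean connectives and $\exists$ have the usual meaning. Two formulas whose free variables are set variables are equivalent if for every graph $G$ and every assignment of vertex sets to the free variables, one holds iff the other holds. -}

module Defs where

open import Data.Nat using (ℕ; zero; suc; NonZero; _≡ᵇ_)
open import Data.Fin using (Fin)
open import Data.Fin.Subset using (Subset; _∈_)
open import Data.Bool using (Bool; true; false; if_then_else_)
open import Data.Vec using (lookup)
open import Data.Product using (Σ; _×_; _,_)
open import Data.Sum using (_⊎_)
open import Relation.Nullary using (¬_)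
open import Relation.Binary.PropositionalEquality using (_≡_; _≢_)
open import Function.Definitions using (Injective)

-- Finite simple vertex-coloured graphs.
-- Vertices are Fin n.  Unary relation symbols P are named by natural
-- numbers; col P is the set P(G).

record Graph : Set where
  field
    n      : ℕ
    adj    : Fin n → Fin n → Bool
    sym    : ∀ u v → adj u v ≡ adj v u
    irrefl : ∀ v → adj v v ≡ false
    col    : ℕ → Subset n

open Graph public

V : Graph → Set
V G = Fin (n G)

Edge : (G : Graph) → V G → V G → Set
Edge G u v = adj G u v ≡ true

-- Walk of length at most r from u to v; dist_G(u,v) ≤ r iff WithinDist G r u v.
data WithinDist (G : Graph) : ℕ → V G → V G → Set where
  here : ∀ {r u} → WithinDist G r u u
  step : ∀ {r u w v} → Edge G u w → WithinDist G r w v → WithinDist G (suc r) u v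

InNbh : (G : Graph) → ℕ → V G → V G → Set
InNbh G r v u = (u ≢ v) × WithinDist G r v u

AtLeast : (G : Graph) → ℕ → (V G → Set) → Set
AtLeast G d P = Σ (Fin d → V G) λ f → Injective _≡_ _≡_ f × (∀ i → P (f i))

AtMost : (G : Graph) → ℕ → (V G → Set) → Set
AtMost G m P = ¬ AtLeast G (suc m) P

Exactly : (G : Graph) → ℕ → (V G → Set) → Set
Exactly G m P = AtLeast G m P × AtMost G m P

SetAssign : Graph → Set
SetAssign G = ℕ → Subset (n G)

update : (G : Graph) → SetAssign G → ℕ → Subset (n G) → SetAssign G
update G β X S Y = if Y ≡ᵇ X then S else β Y

data Term : Set where
  svar  : ℕ → Term
  rel   : ℕ → Term
  empty : Term
  compl : Term → Term
  _∩ₜ_  : Term → Term → Term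
  _∪ₜ_  : Term → Term → Term
  _∖ₜ_  : Term → Term → Term
  nbh   : (d r : ℕ) → {{NonZero d}} → {{NonZero r}} → Term → Term

⟦_⟧ₜ : Term → (G : Graph) → SetAssign G → V G → Set
⟦ svar X ⟧ₜ G β v = v ∈ β X
⟦ rel P ⟧ₜ G β v = v ∈ col G P
⟦ empty ⟧ₜ G β v = Data.Empty.⊥
  where import Data.Empty
⟦ compl t ⟧ₜ G β v = ¬ ⟦ t ⟧ₜ G β v
⟦ t ∩ₜ s ⟧ₜ G β v = ⟦ t ⟧ₜ G β v × ⟦ s ⟧ₜ G β v
⟦ t ∪ₜ s ⟧ₜ G β v = ⟦ t ⟧ₜ G β v ⊎ ⟦ s ⟧ₜ G β v
⟦ t ∖ₜ s ⟧ₜ G β v = ⟦ t ⟧ₜ G β v × ¬ ⟦ s ⟧ₜ G β v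
⟦ nbh d r t ⟧ₜ G β v = AtLeast G d (λ u → InNbh G r v u × ⟦ t ⟧ₜ G β u)

-- Quantifier-free DN formulas with k vertex variables in scope
-- (vertex variables are de Bruijn-style indices Fin k; set variables are named).
data QF (k : ℕ) : Set where
  edge   : Fin k → Fin k → QF k
  eqv    : Fin k → Fin k → QF k
  memb   : Fin k → ℕ → QF k
  relv   : ℕ → Fin k → QF k
  size=  : Term → ℕ → QF k
  size≤  : Term → ℕ → QF k
  size≥  : Term → ℕ → QF k
  teq    : Term → Term → QF k
  tsub   : Term → Term → QF k
  tsup   : Term → Term → QF k
  neg    : QF k → QF k
  _∧q_   : QF k → QF k → QF k
  _∨q_   : QF k → QF k → QF k

data DN (k : ℕ) : Set where
  qf   : QF k → DN k
  _∧ᵈ_ : DN k → DN k → DN k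
  _∨ᵈ_ : DN k → DN k → DN k
  ∃v   : DN (suc k) → DN k                    -- ∃x φ   (x = the new index zero)
  ∃s   : ℕ → DN k → DN k

VertAssign : Graph → ℕ → Set
VertAssign G k = Fin k → V G

extend : (G : Graph) {k : ℕ} → V G → VertAssign G k → VertAssign G (suc k)
extend G v ρ Fin.zero = v
extend G v ρ (Fin.suc i) = ρ i

Subseteq : (G : Graph) → (V G → Set) → (V G → Set) → Set
Subseteq G A B = ∀ v → A v → B v

⟦_⟧q : {k : ℕ} → QF k → (G : Graph) → SetAssign G → VertAssign G k → Set
⟦ edge x y ⟧q G β ρ = Edge G (ρ x) (ρ y)
⟦ eqv x y ⟧q G β ρ = ρ x ≡ ρ y
⟦ memb x X ⟧q G β ρ = ρ x ∈ β X
⟦ relv P x ⟧q G β ρ = ρ x ∈ col G P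
⟦ size= t m ⟧q G β ρ = Exactly G m (⟦ t ⟧ₜ G β)
⟦ size≤ t m ⟧q G β ρ = AtMost G m (⟦ t ⟧ₜ G β)
⟦ size≥ t m ⟧q G β ρ = AtLeast G m (⟦ t ⟧ₜ G β)
⟦ teq t s ⟧q G β ρ = Subseteq G (⟦ t ⟧ₜ G β) (⟦ s ⟧ₜ G β) × Subseteq G (⟦ s ⟧ₜ G β) (⟦ t ⟧ₜ G β)
⟦ tsub t s ⟧q G β ρ = Subseteq G (⟦ t ⟧ₜ G β) (⟦ s ⟧ₜ G β)
⟦ tsup t s ⟧q G β ρ = Subseteq G (⟦ s ⟧ₜ G β) (⟦ t ⟧ₜ G β)
⟦ neg φ ⟧q G β ρ = ¬ ⟦ φ ⟧q G β ρ
⟦ φ ∧q ψ ⟧q G β ρ = ⟦ φ ⟧q G β ρ × ⟦ ψ ⟧q G β ρ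
⟦ φ ∨q ψ ⟧q G β ρ = ⟦ φ ⟧q G β ρ ⊎ ⟦ ψ ⟧q G β ρ

⟦_⟧d : {k : ℕ} → DN k → (G : Graph) → SetAssign G → VertAssign G k → Set
⟦ qf φ ⟧d G β ρ = ⟦ φ ⟧q G β ρ
⟦ φ ∧ᵈ ψ ⟧d G β ρ = ⟦ φ ⟧d G β ρ × ⟦ ψ ⟧d G β ρ
⟦ φ ∨ᵈ ψ ⟧d G β ρ = ⟦ φ ⟧d G β ρ ⊎ ⟦ ψ ⟧d G β ρ
⟦ ∃v φ ⟧d G β ρ = Σ (V G) λ v → ⟦ φ ⟧d G β (extend G v ρ)
⟦ ∃s X φ ⟧d G β ρ = Σ (Subset (n G)) λ S → ⟦ φ ⟧d G (update G β X S) ρ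

DNSentence : Set
DNSentence = DN 0

noVerts : (G : Graph) → VertAssign G 0
noVerts G ()

_⊨ᵈ_[_] : (G : Graph) → DNSentence → SetAssign G → Set
G ⊨ᵈ φ [ β ] = ⟦ φ ⟧d G β (noVerts G)

data Unfinished : Set where
  svar  : ℕ → Unfinished
  rel   : ℕ → Unfinished
  box   : (d r : ℕ) → {{NonZero d}} → {{NonZero r}} → Unfinished → Unfinished
  neg   : Unfinished → Unfinished
  _∧u_  : Unfinished → Unfinished → Unfinished

data Finished : Set where
  gbox  : (d : ℕ) → {{NonZero d}} → Unfinished → Finished
  card≤ : ℕ → ℕ → Finished
  card≥ : ℕ → ℕ → Finished
  neg   : Finished → Finished
  _∧f_  : Finished → Finished → Finished

data EDML : Set where
  fin : Finished → EDML
  ∃s  : ℕ → EDML → EDML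

⟦_⟧u : Unfinished → (G : Graph) → SetAssign G → V G → Set
⟦ svar X ⟧u G β v = v ∈ β X
⟦ rel P ⟧u G β v = v ∈ col G P
⟦ box d r ψ ⟧u G β v = AtLeast G d (λ w → InNbh G r v w × ⟦ ψ ⟧u G β w)
⟦ neg ψ ⟧u G β v = ¬ ⟦ ψ ⟧u G β v
⟦ ψ ∧u χ ⟧u G β v = ⟦ ψ ⟧u G β v × ⟦ χ ⟧u G β v

⟦_⟧f : Finished → (G : Graph) → SetAssign G → Set
⟦ gbox d ψ ⟧f G β = AtLeast G d (⟦ ψ ⟧u G β)
⟦ card≤ X m ⟧f G β = AtMost G m (λ v → v ∈ β X)
⟦ card≥ X m ⟧f G β = AtLeast G m (λ v → v ∈ β X)
⟦ neg ψ ⟧f G β = ¬ ⟦ ψ ⟧f G β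
⟦ ψ ∧f χ ⟧f G β = ⟦ ψ ⟧f G β × ⟦ χ ⟧f G β

_⊨ᵉ_[_] : (G : Graph) → EDML → SetAssign G → Set
G ⊨ᵉ fin ψ [ β ] = ⟦ ψ ⟧f G β
G ⊨ᵉ ∃s X ψ [ β ] = Σ (Subset (n G)) λ S → G ⊨ᵉ ψ [ update G β X S ]

Equivalent : DNSentence → EDML → Set
Equivalent φ ψ = ∀ (G : Graph) (β : SetAssign G) →
  ((G ⊨ᵈ φ [ β ]) → (G ⊨ᵉ ψ [ β ])) × ((G ⊨ᵉ ψ [ β ]) → (G ⊨ᵈ φ [ β ]))

{-# OPTIONS --safe #-}
module Submission where

-- From EDML to DN the translation is literal: □ʳ_d ψ is the term N^r_d(ψ) and ⟩□_d ψ is |ψ| ≥ d.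
-- From DN to EDML, a formula is brought into prenex form over set variables only: a vertex
-- variable becomes a fresh set variable asserted to be a singleton, every set quantifier gets
-- a fresh name, and the quantifier-free parts are expressed by finished formulas
-- (E(x,y) says that the singleton x has a neighbour in the singleton y, t₁ ⊆ t₂ says that
-- no vertex lies in t₁ ∖ t₂, and ∨ is ¬(¬ ∧ ¬)). Because the names bound by different
-- subformulas are disjoint and lie above every name in use, the quantifiers can be pulled out
-- of ∧ and ∨. The classical steps (De Morgan, ⊆ via ∖) are valid because on a finite graph
-- every EDML formula is decidable.

open import Data.Bool using (true; if_then_else_)
open import Data.Bool.Properties using () renaming (_≟_ to _≟ᵇ_)
open import Data.Empty using (⊥-elim)
open import Data.Fin using (Fin; zero; suc; inject≤)
open import Data.Fin.Properties using (any?; injective⇒≤; inject≤-injective; ¬Fin0; 0≢1+n)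
  renaming (_≟_ to _≟ᶠ_)
open import Data.Fin.Subset using (Subset; ⁅_⁆; _∈_)
open import Data.Fin.Subset.Properties using (_∈?_; x∈⁅x⁆; x∈⁅y⁆⇒x≡y; x∈⁅y⁆⇔x≡y; ⊆-antisym)
open import Data.List using (List; []; _∷_; _++_; filter; allFin; length; lookup)
open import Data.List.Membership.Propositional using () renaming (_∈_ to _∈ˡ_)
open import Data.List.Membership.Propositional.Properties using (∈-filter⁺; ∈-filter⁻; ∈-allFin; ∈-lookup)
open import Data.List.Membership.Setoid.Properties using (index-injective)
open import Data.List.Relation.Unary.All as All using (All; []; _∷_)
import Data.List.Relation.Unary.All.Properties as All
open import Data.List.Relation.Unary.AllPairs using (_∷_)
open import Data.List.Relation.Unary.Any using (index)
open import Data.List.Relation.Unary.Unique.Propositional using (Unique)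
open import Data.List.Relation.Unary.Unique.Propositional.Properties using (allFin⁺; filter⁺)
open import Data.Nat using (ℕ; zero; suc; _≤_; _<_; _≤?_; _⊔_; _≡ᵇ_)
open import Data.Nat.Properties using (≤-refl; ≤-trans; <-≤-trans; <⇒≢; n≤1+n; n<1+n; m≤m⊔n; m≤n⊔m)
  renaming (_≟_ to _≟ⁿ_)
open import Data.Product using (Σ; _×_; _,_; proj₁; proj₂)
open import Data.Product.Function.NonDependent.Propositional using (_×-⇔_)
open import Data.Sum using (_⊎_; inj₁; inj₂)
open import Data.Sum.Function.Propositional using (_⊎-⇔_)
open import Data.Unit using (⊤; tt)
open import Function using (_∘_; id)
open import Function.Bundles using (_⇔_; mk⇔; Equivalence)
open import Function.Construct.Identity using (⇔-id)
open import Function.Definitions using (Injective)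
open import Function.Properties.Equivalence using () renaming (refl to ⇔-refl; sym to ⇔-sym; trans to ⇔-trans)
open import Function.Related.Propositional using (module EquationalReasoning; equivalence)
open import Function.Related.TypeIsomorphisms using (¬-cong-⇔)
open import Relation.Binary.PropositionalEquality as ≡ using (_≡_; _≢_; refl; sym; trans; cong; subst)
open import Relation.Nullary using (Dec; yes; no; ¬_; contradiction)
open import Relation.Nullary.Decidable using (_×-dec_; _⊎-dec_; ¬?; map′; decidable-stable; dec-true; dec-false)
open import Relation.Unary using (Decidable)

open import Defs hiding (sym)

open Equivalence using (to; from)

Σ-⇔ : {A : Set} {B C : A → Set} → (∀ x → B x ⇔ C x) → Σ A B ⇔ Σ A C
Σ-⇔ B⇔C = mk⇔ (λ (x , b) → x , to (B⇔C x) b) (λ (x , c) → x , from (B⇔C x) c)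

⊎⇔¬[¬×¬] : {A B : Set} → Dec A → Dec B → (A ⊎ B) ⇔ (¬ (¬ A × ¬ B))
⊎⇔¬[¬×¬] a? b? = mk⇔
  (λ { (inj₁ a) (¬a , _) → ¬a a ; (inj₂ b) (_ , ¬b) → ¬b b })
  (λ ¬[¬a×¬b] → decidable-stable (a? ⊎-dec b?) λ ¬a⊎b → ¬[¬a×¬b] (¬a⊎b ∘ inj₁ , ¬a⊎b ∘ inj₂))

-- Counting vertices and decidability

lookup-injective : {A : Set} {xs : List A} → Unique xs → ∀ i j → lookup xs i ≡ lookup xs j → i ≡ j
lookup-injective {xs = x ∷ xs} (x∉xs ∷ u) zero    zero    eq = refl
lookup-injective {xs = x ∷ xs} (x∉xs ∷ u) zero    (suc j) eq = ⊥-elim (All.lookup x∉xs (∈-lookup j) eq)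
lookup-injective {xs = x ∷ xs} (x∉xs ∷ u) (suc i) zero    eq = ⊥-elim (All.lookup x∉xs (∈-lookup i) (sym eq))
lookup-injective {xs = x ∷ xs} (x∉xs ∷ u) (suc i) (suc j) eq = cong suc (lookup-injective u i j eq)

module _ (G : Graph) {P : V G → Set} (P? : Decidable P) where

  private
    elems : List (V G)
    elems = filter P? (allFin (n G))

  ≤-length⇒AtLeast : ∀ {d} → d ≤ length elems → AtLeast G d P
  ≤-length⇒AtLeast d≤ =
    (λ i → lookup elems (inject≤ i d≤)) ,
    (λ {i} {j} eq → inject≤-injective d≤ d≤ i j (lookup-injective (filter⁺ P? (allFin⁺ (n G))) _ _ eq)) ,
    (λ i → proj₂ (∈-filter⁻ P? {xs = allFin (n G)} (∈-lookup (inject≤ i d≤))))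

  AtLeast⇒≤-length : ∀ {d} → AtLeast G d P → d ≤ length elems
  AtLeast⇒≤-length (f , f-inj , Pf) =
    injective⇒≤ {f = index ∘ f∈} (f-inj ∘ index-injective (≡.setoid _) (f∈ _) (f∈ _))
    where
    f∈ : ∀ i → f i ∈ˡ elems
    f∈ i = ∈-filter⁺ P? (∈-allFin (f i)) (Pf i)

  AtLeast? : ∀ d → Dec (AtLeast G d P)
  AtLeast? d = map′ ≤-length⇒AtLeast AtLeast⇒≤-length (d ≤? length elems)

module _ {G : Graph} where

  AtLeast-map : ∀ {d} {P Q : V G → Set} → (∀ {v} → P v → Q v) → AtLeast G d P → AtLeast G d Q
  AtLeast-map P⇒Q (f , f-inj , Pf) = f , f-inj , P⇒Q ∘ Pf

  AtLeast-cong : ∀ {d} {P Q : V G → Set} → (∀ v → P v ⇔ Q v) → AtLeast G d P ⇔ AtLeast G d Q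
  AtLeast-cong P⇔Q = mk⇔ (AtLeast-map λ {v} → to (P⇔Q v)) (AtLeast-map λ {v} → from (P⇔Q v))

  AtLeast-nbh-cong : ∀ {d r v} {P Q : V G → Set} → (∀ w → P w ⇔ Q w) →
                     AtLeast G d (λ w → InNbh G r v w × P w) ⇔ AtLeast G d (λ w → InNbh G r v w × Q w)
  AtLeast-nbh-cong {r = r} {v} P⇔Q = AtLeast-cong λ w → ⇔-id (InNbh G r v w) ×-⇔ P⇔Q w

  AtLeast-zero : {P : V G → Set} → AtLeast G 0 P
  AtLeast-zero = (λ ()) , (λ {i} → ⊥-elim (¬Fin0 i)) , (λ ())

  AtLeast-one : {P : V G → Set} → AtLeast G 1 P ⇔ Σ (V G) P
  AtLeast-one = mk⇔ (λ (f , _ , Pf) → f zero , Pf zero) (λ (v , Pv) → (λ _ → v) , const-injective , λ _ → Pv)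
    where
    const-injective : ∀ {v} → Injective _≡_ _≡_ (λ (_ : Fin 1) → v)
    const-injective {_} {zero} {zero} _ = refl

  AtLeast-two : {P : V G → Set} {u v : V G} → u ≢ v → P u → P v → AtLeast G 2 P
  AtLeast-two {u = u} {v} u≢v Pu Pv = pair , pair-injective , λ { zero → Pu ; (suc zero) → Pv }
    where
    pair : Fin 2 → V G
    pair zero    = u
    pair (suc _) = v
    pair-injective : Injective _≡_ _≡_ pair
    pair-injective {zero}     {zero}     _  = refl
    pair-injective {zero}     {suc zero} eq = contradiction eq u≢v
    pair-injective {suc zero} {zero}     eq = contradiction (sym eq) u≢v
    pair-injective {suc zero} {suc zero} _  = refl

  WithinDist? : ∀ r u v → Dec (WithinDist G r u v)
  WithinDist? r u v with u ≟ᶠ v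
  ... | yes refl = yes here
  WithinDist? zero    u v | no u≢v = no λ { here → u≢v refl }
  WithinDist? (suc r) u v | no u≢v with any? (λ w → (adj G u w ≟ᵇ true) ×-dec WithinDist? r w v)
  ... | yes (w , e , p) = yes (step e p)
  ... | no ¬step        = no λ { here → u≢v refl ; (step {w = w} e p) → ¬step (w , e , p) }

  InNbh? : ∀ r v u → Dec (InNbh G r v u)
  InNbh? r v u = ¬? (u ≟ᶠ v) ×-dec WithinDist? r v u

  InNbh-one⇔Edge : ∀ {u v} → InNbh G 1 u v ⇔ Edge G u v
  InNbh-one⇔Edge {u} {v} =
    mk⇔ to′ λ e → (λ { refl → contradiction (trans (sym e) (irrefl G u)) λ () }) , step e here
    where
    to′ : InNbh G 1 u v → Edge G u v
    to′ (v≢u , here)      = contradiction refl v≢u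
    to′ (_ , step e here) = e

  ⟦_⟧u? : ∀ ψ β v → Dec (⟦ ψ ⟧u G β v)
  ⟦ svar X ⟧u?    β v = v ∈? β X
  ⟦ rel P ⟧u?     β v = v ∈? col G P
  ⟦ box d r ψ ⟧u? β v = AtLeast? G (λ w → InNbh? r v w ×-dec ⟦ ψ ⟧u? β w) d
  ⟦ neg ψ ⟧u?     β v = ¬? (⟦ ψ ⟧u? β v)
  ⟦ ψ ∧u χ ⟧u?    β v = ⟦ ψ ⟧u? β v ×-dec ⟦ χ ⟧u? β v

  ⟦_⟧f? : ∀ ψ β → Dec (⟦ ψ ⟧f G β)
  ⟦ gbox d ψ ⟧f?  β = AtLeast? G (⟦ ψ ⟧u? β) d
  ⟦ card≤ X m ⟧f? β = ¬? (AtLeast? G (_∈? β X) (suc m))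
  ⟦ card≥ X m ⟧f? β = AtLeast? G (_∈? β X) m
  ⟦ neg ψ ⟧f?     β = ¬? (⟦ ψ ⟧f? β)
  ⟦ ψ ∧f χ ⟧f?    β = ⟦ ψ ⟧f? β ×-dec ⟦ χ ⟧f? β

-- Assignments and blocks of set quantifiers

_[_≔_] : {A : Set} → (ℕ → A) → ℕ → A → ℕ → A
(f [ X ≔ a ]) Y = if Y ≡ᵇ X then a else f Y

module _ {A : Set} (f : ℕ → A) (X : ℕ) (a : A) where

  [≔]-same : (f [ X ≔ a ]) X ≡ a
  [≔]-same rewrite dec-true (X ≟ⁿ X) refl = refl

  [≔]-other : ∀ {Y} → Y ≢ X → (f [ X ≔ a ]) Y ≡ f Y
  [≔]-other {Y} Y≢X rewrite dec-false (Y ≟ⁿ X) Y≢X = refl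

[≔]-self : {A : Set} (f : ℕ → A) (X Y : ℕ) → (f [ X ≔ f X ]) Y ≡ f Y
[≔]-self f X Y with Y ≟ⁿ X
... | yes refl = [≔]-same f X (f X)
... | no Y≢X   = [≔]-other f X (f X) Y≢X

Agree : {A : Set} → ℕ → (ℕ → A) → (ℕ → A) → Set
Agree b f g = ∀ {Y} → Y < b → f Y ≡ g Y

Agree-trans : {A : Set} {b : ℕ} {f g h : ℕ → A} → Agree b f g → Agree b g h → Agree b f h
Agree-trans f≈g g≈h Y<b = trans (f≈g Y<b) (g≈h Y<b)

[≔]-agree : {A : Set} {b X : ℕ} (f : ℕ → A) (a : A) → b ≤ X → Agree b (f [ X ≔ a ]) f
[≔]-agree f a b≤X Y<b = [≔]-other f _ a (<⇒≢ (<-≤-trans Y<b b≤X))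

Local : (G : Graph) → ℕ → (SetAssign G → Set) → Set
Local G b P = ∀ {β β′} → Agree b β β′ → P β ⇔ P β′

Exists : (G : Graph) → List ℕ → (SetAssign G → Set) → SetAssign G → Set
Exists G []       P β = P β
Exists G (X ∷ Xs) P β = Σ (Subset (n G)) λ S → Exists G Xs P (update G β X S)

module _ {G : Graph} where

  Exists-map : ∀ Xs {P Q : SetAssign G → Set} → (∀ {β} → P β → Q β) →
               ∀ {β} → Exists G Xs P β → Exists G Xs Q β
  Exists-map []       P⇒Q p       = P⇒Q p
  Exists-map (X ∷ Xs) P⇒Q (S , p) = S , Exists-map Xs P⇒Q p

  Exists-cong : ∀ Xs {P Q : SetAssign G → Set} → (∀ β → P β ⇔ Q β) →
                ∀ {β} → Exists G Xs P β ⇔ Exists G Xs Q β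
  Exists-cong Xs P⇔Q = mk⇔ (Exists-map Xs (to (P⇔Q _))) (Exists-map Xs (from (P⇔Q _)))

  Exists-++ : ∀ Xs Ys {P : SetAssign G → Set} {β} →
              Exists G (Xs ++ Ys) P β ⇔ Exists G Xs (Exists G Ys P) β
  Exists-++ []       Ys = ⇔-refl
  Exists-++ (X ∷ Xs) Ys = Σ-⇔ λ S → Exists-++ Xs Ys

  Exists-⊎ : ∀ Xs {P Q : SetAssign G → Set} {β} →
             Exists G Xs (λ β′ → P β′ ⊎ Q β′) β → Exists G Xs P β ⊎ Exists G Xs Q β
  Exists-⊎ []       p = p
  Exists-⊎ (X ∷ Xs) (S , p) with Exists-⊎ Xs p
  ... | inj₁ q = inj₁ (S , q)
  ... | inj₂ q = inj₂ (S , q)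

  Exists-unchanged : ∀ Xs {P : SetAssign G → Set} {β} → (∀ {β′} → (∀ Y → β′ Y ≡ β Y) → P β′) →
                     Exists G Xs P β
  Exists-unchanged []       P-at-β = P-at-β λ _ → refl
  Exists-unchanged (X ∷ Xs) {β = β} P-at-β =
    β X , Exists-unchanged Xs λ β′≡ → P-at-β λ Y → trans (β′≡ Y) ([≔]-self β X Y)

  module _ {b : ℕ} where

    Exists-witness : ∀ {Xs} → All (b ≤_) Xs → ∀ {P : SetAssign G → Set} {β} →
                     Exists G Xs P β → Σ (SetAssign G) λ β′ → Agree b β′ β × P β′
    Exists-witness {[]}     []           {β = β} p = β , (λ _ → refl) , p
    Exists-witness {X ∷ Xs} (b≤X ∷ Xs≥b) {β = β} (S , p) with Exists-witness Xs≥b p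
    ... | β′ , β′≈ , q = β′ , Agree-trans β′≈ ([≔]-agree β S b≤X) , q

    Exists-map-agree : ∀ {Xs} → All (b ≤_) Xs → ∀ {P Q : SetAssign G → Set} {β} →
                       (∀ {β′} → Agree b β′ β → P β′ → Q β′) → Exists G Xs P β → Exists G Xs Q β
    Exists-map-agree {[]}     []           P⇒Q p = P⇒Q (λ _ → refl) p
    Exists-map-agree {X ∷ Xs} (b≤X ∷ Xs≥b) {β = β} P⇒Q (S , p) =
      S , Exists-map-agree Xs≥b (λ β′≈ → P⇒Q (Agree-trans β′≈ ([≔]-agree β S b≤X))) p

    module _ {Xs} (Xs≥b : All (b ≤_) Xs) {P Q : SetAssign G → Set} {B : Set} {β : SetAssign G} where

      Exists-×ˡ : (∀ {β′} → Agree b β′ β → P β′ ⇔ B) →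
                  Exists G Xs (λ β′ → P β′ × Q β′) β ⇔ (B × Exists G Xs Q β)
      Exists-×ˡ P≈B = mk⇔
        (λ e → let _ , β′≈ , p , _ = Exists-witness Xs≥b {P = λ β′ → P β′ × Q β′} e
               in to (P≈B β′≈) p , Exists-map Xs proj₂ e)
        (λ (b , e) → Exists-map-agree Xs≥b (λ β′≈ q → from (P≈B β′≈) b , q) e)

      Exists-×ʳ : (∀ {β′} → Agree b β′ β → Q β′ ⇔ B) →
                  Exists G Xs (λ β′ → P β′ × Q β′) β ⇔ (Exists G Xs P β × B)
      Exists-×ʳ Q≈B = mk⇔
        (λ e → let _ , β′≈ , _ , q = Exists-witness Xs≥b {P = λ β′ → P β′ × Q β′} e
               in Exists-map Xs proj₁ e , to (Q≈B β′≈) q)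
        (λ (e , b) → Exists-map-agree Xs≥b (λ β′≈ p → p , from (Q≈B β′≈) b) e)

      Exists-⊎ˡ : (∀ {β′} → Agree b β′ β → P β′ ⇔ B) →
                  Exists G Xs (λ β′ → P β′ ⊎ Q β′) β ⇔ (B ⊎ Exists G Xs Q β)
      Exists-⊎ˡ P≈B = mk⇔ to′ from′
        where
        to′ : Exists G Xs (λ β′ → P β′ ⊎ Q β′) β → B ⊎ Exists G Xs Q β
        to′ e with Exists-⊎ Xs e
        ... | inj₁ e′ = let _ , β′≈ , p = Exists-witness Xs≥b {P = P} e′ in inj₁ (to (P≈B β′≈) p)
        ... | inj₂ e′ = inj₂ e′
        from′ : B ⊎ Exists G Xs Q β → Exists G Xs (λ β′ → P β′ ⊎ Q β′) β
        from′ (inj₁ b) = Exists-unchanged Xs λ β′≡ → inj₁ (from (P≈B (λ {Y} _ → β′≡ Y)) b)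
        from′ (inj₂ e) = Exists-map Xs inj₂ e

      Exists-⊎ʳ : (∀ {β′} → Agree b β′ β → Q β′ ⇔ B) →
                  Exists G Xs (λ β′ → P β′ ⊎ Q β′) β ⇔ (Exists G Xs P β ⊎ B)
      Exists-⊎ʳ Q≈B = mk⇔ to′ from′
        where
        to′ : Exists G Xs (λ β′ → P β′ ⊎ Q β′) β → Exists G Xs P β ⊎ B
        to′ e with Exists-⊎ Xs e
        ... | inj₁ e′ = inj₁ e′
        ... | inj₂ e′ = let _ , β′≈ , q = Exists-witness Xs≥b {P = Q} e′ in inj₂ (to (Q≈B β′≈) q)
        from′ : Exists G Xs P β ⊎ B → Exists G Xs (λ β′ → P β′ ⊎ Q β′) β
        from′ (inj₁ e) = Exists-map Xs inj₁ e
        from′ (inj₂ b) = Exists-unchanged Xs λ β′≡ → inj₂ (from (Q≈B (λ {Y} _ → β′≡ Y)) b)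

module _ {G : Graph} {x y : ℕ} {Xs Ys : List ℕ} (Xs≥x : All (x ≤_) Xs) (Ys≥y : All (y ≤_) Ys)
         {P Q : SetAssign G → Set} (P-local : Local G y P) {B : Set} {β : SetAssign G}
         (Q≈B : ∀ {β₁} → Agree x β₁ β → Exists G Ys Q β₁ ⇔ B) where

  open EquationalReasoning {k = equivalence}

  Exists-++-× : (Exists G Xs P β × B) ⇔ Exists G (Xs ++ Ys) (λ β′ → P β′ × Q β′) β
  Exists-++-× = begin
    (Exists G Xs P β × B)                              ∼⟨ ⇔-sym (Exists-×ʳ Xs≥x Q≈B) ⟩
    Exists G Xs (λ β₁ → P β₁ × Exists G Ys Q β₁) β    ∼⟨ ⇔-sym (Exists-cong Xs λ _ → Exists-×ˡ Ys≥y P-local) ⟩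
    Exists G Xs (Exists G Ys (λ β₂ → P β₂ × Q β₂)) β  ∼⟨ ⇔-sym (Exists-++ Xs Ys) ⟩
    Exists G (Xs ++ Ys) (λ β′ → P β′ × Q β′) β        ∎

  Exists-++-⊎ : (Exists G Xs P β ⊎ B) ⇔ Exists G (Xs ++ Ys) (λ β′ → P β′ ⊎ Q β′) β
  Exists-++-⊎ = begin
    (Exists G Xs P β ⊎ B)                              ∼⟨ ⇔-sym (Exists-⊎ʳ Xs≥x Q≈B) ⟩
    Exists G Xs (λ β₁ → P β₁ ⊎ Exists G Ys Q β₁) β    ∼⟨ ⇔-sym (Exists-cong Xs λ _ → Exists-⊎ˡ Ys≥y P-local) ⟩
    Exists G Xs (Exists G Ys (λ β₂ → P β₂ ⊎ Q β₂)) β  ∼⟨ ⇔-sym (Exists-++ Xs Ys) ⟩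
    Exists G (Xs ++ Ys) (λ β′ → P β′ ⊎ Q β′) β        ∎

-- From EDML to DN

toTerm : Unfinished → Term
toTerm (svar X)    = svar X
toTerm (rel P)     = rel P
toTerm (box d r ψ) = nbh d r (toTerm ψ)
toTerm (neg ψ)     = compl (toTerm ψ)
toTerm (ψ ∧u χ)    = toTerm ψ ∩ₜ toTerm χ

toQF : ∀ {k} → Finished → QF k
toQF (gbox d ψ)  = size≥ (toTerm ψ) d
toQF (card≤ X m) = size≤ (svar X) m
toQF (card≥ X m) = size≥ (svar X) m
toQF (neg ψ)     = neg (toQF ψ)
toQF (ψ ∧f χ)    = toQF ψ ∧q toQF χ

toDN : ∀ {k} → EDML → DN k
toDN (fin ψ)  = qf (toQF ψ)
toDN (∃s X ψ) = ∃s X (toDN ψ)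

module _ {G : Graph} where

  toTerm-sound : ∀ ψ β v → ⟦ toTerm ψ ⟧ₜ G β v ⇔ ⟦ ψ ⟧u G β v
  toTerm-sound (svar X)    β v = ⇔-refl
  toTerm-sound (rel P)     β v = ⇔-refl
  toTerm-sound (box d r ψ) β v = AtLeast-nbh-cong (toTerm-sound ψ β)
  toTerm-sound (neg ψ)     β v = ¬-cong-⇔ (toTerm-sound ψ β v)
  toTerm-sound (ψ ∧u χ)    β v = toTerm-sound ψ β v ×-⇔ toTerm-sound χ β v

  toQF-sound : ∀ {k} ψ β (ρ : VertAssign G k) → ⟦ toQF ψ ⟧q G β ρ ⇔ ⟦ ψ ⟧f G β
  toQF-sound (gbox d ψ)  β ρ = AtLeast-cong {G = G} (toTerm-sound ψ β)
  toQF-sound (card≤ X m) β ρ = ⇔-refl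
  toQF-sound (card≥ X m) β ρ = ⇔-refl
  toQF-sound (neg ψ)     β ρ = ¬-cong-⇔ (toQF-sound ψ β ρ)
  toQF-sound (ψ ∧f χ)    β ρ = toQF-sound ψ β ρ ×-⇔ toQF-sound χ β ρ

  toDN-sound : ∀ {k} ψ β (ρ : VertAssign G k) → ⟦ toDN ψ ⟧d G β ρ ⇔ (G ⊨ᵉ ψ [ β ])
  toDN-sound (fin ψ)  β ρ = toQF-sound ψ β ρ
  toDN-sound (∃s X ψ) β ρ = Σ-⇔ λ S → toDN-sound ψ (update G β X S) ρ

-- Bounds on the names of set variables

VarsBelowu : ℕ → Unfinished → Set
VarsBelowu b (svar X)    = X < b
VarsBelowu b (rel P)     = ⊤
VarsBelowu b (box d r ψ) = VarsBelowu b ψ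
VarsBelowu b (neg ψ)     = VarsBelowu b ψ
VarsBelowu b (ψ ∧u χ)    = VarsBelowu b ψ × VarsBelowu b χ

VarsBelowf : ℕ → Finished → Set
VarsBelowf b (gbox d ψ)  = VarsBelowu b ψ
VarsBelowf b (card≤ X m) = X < b
VarsBelowf b (card≥ X m) = X < b
VarsBelowf b (neg ψ)     = VarsBelowf b ψ
VarsBelowf b (ψ ∧f χ)    = VarsBelowf b ψ × VarsBelowf b χ

module _ {G : Graph} {b : ℕ} where

  ⟦⟧u-local : ∀ ψ → VarsBelowu b ψ → ∀ {β β′} → Agree b β β′ → ∀ v → ⟦ ψ ⟧u G β v ⇔ ⟦ ψ ⟧u G β′ v
  ⟦⟧u-local (svar X)    X<b         β≈β′ v rewrite β≈β′ X<b = ⇔-refl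
  ⟦⟧u-local (rel P)     _           β≈β′ v = ⇔-refl
  ⟦⟧u-local (box d r ψ) ψ<b         β≈β′ v = AtLeast-nbh-cong (⟦⟧u-local ψ ψ<b β≈β′)
  ⟦⟧u-local (neg ψ)     ψ<b         β≈β′ v = ¬-cong-⇔ (⟦⟧u-local ψ ψ<b β≈β′ v)
  ⟦⟧u-local (ψ ∧u χ)    (ψ<b , χ<b) β≈β′ v = ⟦⟧u-local ψ ψ<b β≈β′ v ×-⇔ ⟦⟧u-local χ χ<b β≈β′ v

  ⟦⟧f-local : ∀ ψ → VarsBelowf b ψ → Local G b (⟦ ψ ⟧f G)
  ⟦⟧f-local (gbox d ψ)  ψ<b         β≈β′ = AtLeast-cong {G = G} (⟦⟧u-local ψ ψ<b β≈β′)
  ⟦⟧f-local (card≤ X m) X<b         β≈β′ rewrite β≈β′ X<b = ⇔-refl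
  ⟦⟧f-local (card≥ X m) X<b         β≈β′ rewrite β≈β′ X<b = ⇔-refl
  ⟦⟧f-local (neg ψ)     ψ<b         β≈β′ = ¬-cong-⇔ (⟦⟧f-local ψ ψ<b β≈β′)
  ⟦⟧f-local (ψ ∧f χ)    (ψ<b , χ<b) β≈β′ = ⟦⟧f-local ψ ψ<b β≈β′ ×-⇔ ⟦⟧f-local χ χ<b β≈β′

VarsBelowₜ : ℕ → Term → Set
VarsBelowₜ M (svar X)    = X < M
VarsBelowₜ M (rel P)     = ⊤
VarsBelowₜ M empty       = ⊤
VarsBelowₜ M (compl t)   = VarsBelowₜ M t
VarsBelowₜ M (t ∩ₜ s)    = VarsBelowₜ M t × VarsBelowₜ M s
VarsBelowₜ M (t ∪ₜ s)    = VarsBelowₜ M t × VarsBelowₜ M s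
VarsBelowₜ M (t ∖ₜ s)    = VarsBelowₜ M t × VarsBelowₜ M s
VarsBelowₜ M (nbh d r t) = VarsBelowₜ M t

VarsBelowq : ∀ {k} → ℕ → QF k → Set
VarsBelowq M (edge x y)  = ⊤
VarsBelowq M (eqv x y)   = ⊤
VarsBelowq M (memb x X)  = X < M
VarsBelowq M (relv P x)  = ⊤
VarsBelowq M (size= t m) = VarsBelowₜ M t
VarsBelowq M (size≤ t m) = VarsBelowₜ M t
VarsBelowq M (size≥ t m) = VarsBelowₜ M t
VarsBelowq M (teq t s)   = VarsBelowₜ M t × VarsBelowₜ M s
VarsBelowq M (tsub t s)  = VarsBelowₜ M t × VarsBelowₜ M s
VarsBelowq M (tsup t s)  = VarsBelowₜ M t × VarsBelowₜ M s
VarsBelowq M (neg φ)     = VarsBelowq M φ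
VarsBelowq M (φ ∧q ψ)    = VarsBelowq M φ × VarsBelowq M ψ
VarsBelowq M (φ ∨q ψ)    = VarsBelowq M φ × VarsBelowq M ψ

VarsBelowd : ∀ {k} → ℕ → DN k → Set
VarsBelowd M (qf φ)   = VarsBelowq M φ
VarsBelowd M (φ ∧ᵈ ψ) = VarsBelowd M φ × VarsBelowd M ψ
VarsBelowd M (φ ∨ᵈ ψ) = VarsBelowd M φ × VarsBelowd M ψ
VarsBelowd M (∃v φ)   = VarsBelowd M φ
VarsBelowd M (∃s X φ) = VarsBelowd M φ

Eventually : (ℕ → Set) → Set
Eventually P = Σ ℕ λ M → ∀ {M′} → M ≤ M′ → P M′

Eventually-× : {P Q : ℕ → Set} → Eventually P → Eventually Q → Eventually (λ M → P M × Q M)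
Eventually-× (M , P↑) (N , Q↑) = M ⊔ N , λ le → P↑ (≤-trans (m≤m⊔n M N) le) , Q↑ (≤-trans (m≤n⊔m M N) le)

Eventually-< : ∀ X → Eventually (X <_)
Eventually-< X = suc X , id

Eventually-⊤ : Eventually (λ _ → ⊤)
Eventually-⊤ = 0 , λ _ → tt

VarsBelowₜ-eventually : ∀ t → Eventually (λ M → VarsBelowₜ M t)
VarsBelowₜ-eventually (svar X)    = Eventually-< X
VarsBelowₜ-eventually (rel P)     = Eventually-⊤
VarsBelowₜ-eventually empty       = Eventually-⊤
VarsBelowₜ-eventually (compl t)   = VarsBelowₜ-eventually t
VarsBelowₜ-eventually (t ∩ₜ s)    = Eventually-× (VarsBelowₜ-eventually t) (VarsBelowₜ-eventually s)
VarsBelowₜ-eventually (t ∪ₜ s)    = Eventually-× (VarsBelowₜ-eventually t) (VarsBelowₜ-eventually s)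
VarsBelowₜ-eventually (t ∖ₜ s)    = Eventually-× (VarsBelowₜ-eventually t) (VarsBelowₜ-eventually s)
VarsBelowₜ-eventually (nbh d r t) = VarsBelowₜ-eventually t

VarsBelowq-eventually : ∀ {k} (φ : QF k) → Eventually (λ M → VarsBelowq M φ)
VarsBelowq-eventually (edge x y)  = Eventually-⊤
VarsBelowq-eventually (eqv x y)   = Eventually-⊤
VarsBelowq-eventually (memb x X)  = Eventually-< X
VarsBelowq-eventually (relv P x)  = Eventually-⊤
VarsBelowq-eventually (size= t m) = VarsBelowₜ-eventually t
VarsBelowq-eventually (size≤ t m) = VarsBelowₜ-eventually t
VarsBelowq-eventually (size≥ t m) = VarsBelowₜ-eventually t
VarsBelowq-eventually (teq t s)   = Eventually-× (VarsBelowₜ-eventually t) (VarsBelowₜ-eventually s)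
VarsBelowq-eventually (tsub t s)  = Eventually-× (VarsBelowₜ-eventually t) (VarsBelowₜ-eventually s)
VarsBelowq-eventually (tsup t s)  = Eventually-× (VarsBelowₜ-eventually t) (VarsBelowₜ-eventually s)
VarsBelowq-eventually (neg φ)     = VarsBelowq-eventually φ
VarsBelowq-eventually (φ ∧q ψ)    = Eventually-× (VarsBelowq-eventually φ) (VarsBelowq-eventually ψ)
VarsBelowq-eventually (φ ∨q ψ)    = Eventually-× (VarsBelowq-eventually φ) (VarsBelowq-eventually ψ)

VarsBelowd-eventually : ∀ {k} (φ : DN k) → Eventually (λ M → VarsBelowd M φ)
VarsBelowd-eventually (qf φ)   = VarsBelowq-eventually φ
VarsBelowd-eventually (φ ∧ᵈ ψ) = Eventually-× (VarsBelowd-eventually φ) (VarsBelowd-eventually ψ)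
VarsBelowd-eventually (φ ∨ᵈ ψ) = Eventually-× (VarsBelowd-eventually φ) (VarsBelowd-eventually ψ)
VarsBelowd-eventually (∃v φ)   = VarsBelowd-eventually φ
VarsBelowd-eventually (∃s X φ) = VarsBelowd-eventually φ

-- Derived EDML formulas

module _ {m : ℕ} {S : Subset m} {a : Fin m} (S≡⁅a⁆ : S ≡ ⁅ a ⁆) where

  ∈-singleton⇒≡ : ∀ {w} → w ∈ S → w ≡ a
  ∈-singleton⇒≡ {w} w∈S = x∈⁅y⁆⇒x≡y a (subst (w ∈_) S≡⁅a⁆ w∈S)

  ∈-singleton : a ∈ S
  ∈-singleton = subst (a ∈_) (sym S≡⁅a⁆) (x∈⁅x⁆ a)

  module _ {Q : Fin m → Set} where

    ∃∈-singletonˡ : Σ (Fin m) (λ w → w ∈ S × Q w) ⇔ Q a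
    ∃∈-singletonˡ = mk⇔ (λ (w , w∈S , Qw) → subst Q (∈-singleton⇒≡ w∈S) Qw) (λ Qa → a , ∈-singleton , Qa)

    ∃∈-singletonʳ : Σ (Fin m) (λ w → Q w × w ∈ S) ⇔ Q a
    ∃∈-singletonʳ = mk⇔ (λ (w , Qw , w∈S) → subst Q (∈-singleton⇒≡ w∈S) Qw) (λ Qa → a , Qa , ∈-singleton)

Subseteq-cong : ∀ {G} {P P′ Q Q′ : V G → Set} → (∀ v → P v ⇔ P′ v) → (∀ v → Q v ⇔ Q′ v) →
                Subseteq G P Q ⇔ Subseteq G P′ Q′
Subseteq-cong P⇔P′ Q⇔Q′ = mk⇔ (λ P⊆Q v → to (Q⇔Q′ v) ∘ P⊆Q v ∘ from (P⇔P′ v))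
                              (λ P′⊆Q′ v → from (Q⇔Q′ v) ∘ P′⊆Q′ v ∘ to (P⇔P′ v))

⊥u : Unfinished
⊥u = rel 0 ∧u neg (rel 0)

⊤f : Finished
⊤f = neg (gbox 1 ⊥u)

_∨u_ : Unfinished → Unfinished → Unfinished
ψ ∨u χ = neg (neg ψ ∧u neg χ)

_∨f_ : Finished → Finished → Finished
ψ ∨f χ = neg (neg ψ ∧f neg χ)

atLeastf : Unfinished → ℕ → Finished
atLeastf ψ zero    = ⊤f
atLeastf ψ (suc m) = gbox (suc m) ψ

atMostf : Unfinished → ℕ → Finished
atMostf ψ m = neg (gbox (suc m) ψ)

_⊆f_ : Unfinished → Unfinished → Finished
ψ ⊆f χ = neg (gbox 1 (ψ ∧u neg χ))

_at_ : Unfinished → ℕ → Finished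
ψ at X = gbox 1 (svar X ∧u ψ)

isSingleton : ℕ → Finished
isSingleton X = card≥ X 1 ∧f card≤ X 1

module _ {G : Graph} {β : SetAssign G} where

  ⊤f-holds : ⟦ ⊤f ⟧f G β
  ⊤f-holds (f , _ , ⊥f) = proj₂ (⊥f zero) (proj₁ (⊥f zero))

  ∨u-sound : ∀ ψ χ v → (⟦ ψ ⟧u G β v ⊎ ⟦ χ ⟧u G β v) ⇔ ⟦ ψ ∨u χ ⟧u G β v
  ∨u-sound ψ χ v = ⊎⇔¬[¬×¬] (⟦ ψ ⟧u? β v) (⟦ χ ⟧u? β v)

  ∨f-sound : ∀ ψ χ → (⟦ ψ ⟧f G β ⊎ ⟦ χ ⟧f G β) ⇔ ⟦ ψ ∨f χ ⟧f G β
  ∨f-sound ψ χ = ⊎⇔¬[¬×¬] (⟦ ψ ⟧f? β) (⟦ χ ⟧f? β)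

  atLeastf-sound : ∀ ψ m → AtLeast G m (⟦ ψ ⟧u G β) ⇔ ⟦ atLeastf ψ m ⟧f G β
  atLeastf-sound ψ zero    = mk⇔ (λ _ → ⊤f-holds) (λ _ → AtLeast-zero {G = G} {P = ⟦ ψ ⟧u G β})
  atLeastf-sound ψ (suc m) = ⇔-refl

  ⊆f-sound : ∀ ψ χ → Subseteq G (⟦ ψ ⟧u G β) (⟦ χ ⟧u G β) ⇔ ⟦ ψ ⊆f χ ⟧f G β
  ⊆f-sound ψ χ = mk⇔
    (λ ψ⊆χ (f , _ , p) → proj₂ (p zero) (ψ⊆χ (f zero) (proj₁ (p zero))))
    (λ ¬ψ∖χ v ψv → decidable-stable (⟦ χ ⟧u? β v) λ ¬χv → ¬ψ∖χ (from (AtLeast-one {G = G}) (v , ψv , ¬χv)))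

  at-sound : ∀ ψ {X a} → β X ≡ ⁅ a ⁆ → ⟦ ψ ⟧u G β a ⇔ ⟦ ψ at X ⟧f G β
  at-sound ψ βX≡⁅a⁆ = ⇔-sym (⇔-trans (AtLeast-one {G = G}) (∃∈-singletonˡ βX≡⁅a⁆))

  isSingleton-sound : ∀ X {S} → β X ≡ S → (Σ (V G) λ a → S ≡ ⁅ a ⁆) ⇔ ⟦ isSingleton X ⟧f G β
  isSingleton-sound X refl = mk⇔ to′ from′
    where
    to′ : Σ (V G) (λ a → β X ≡ ⁅ a ⁆) → ⟦ isSingleton X ⟧f G β
    to′ (a , βX≡⁅a⁆) = from (AtLeast-one {G = G}) (a , ∈-singleton βX≡⁅a⁆) , λ (f , f-inj , f∈) →
      0≢1+n (f-inj (trans (∈-singleton⇒≡ βX≡⁅a⁆ (f∈ zero)) (sym (∈-singleton⇒≡ βX≡⁅a⁆ (f∈ (suc zero))))))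
    from′ : ⟦ isSingleton X ⟧f G β → Σ (V G) (λ a → β X ≡ ⁅ a ⁆)
    from′ ((f , _ , f∈) , ¬two) =
      f zero , ⊆-antisym (λ u∈ → subst (_∈ ⁅ f zero ⁆) (sym (≡f0 u∈)) (x∈⁅x⁆ (f zero)))
                         (λ u∈⁅f0⁆ → subst (_∈ β X) (sym (x∈⁅y⁆⇒x≡y (f zero) u∈⁅f0⁆)) (f∈ zero))
      where
      ≡f0 : ∀ {u} → u ∈ β X → u ≡ f zero
      ≡f0 {u} u∈ = decidable-stable (u ≟ᶠ f zero) λ u≢f0 → ¬two (AtLeast-two {G = G} u≢f0 u∈ (f∈ zero))

-- From DN to EDML

toUnfinished : (ℕ → ℕ) → Term → Unfinished
toUnfinished σ (svar X)    = svar (σ X)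
toUnfinished σ (rel P)     = rel P
toUnfinished σ empty       = ⊥u
toUnfinished σ (compl t)   = neg (toUnfinished σ t)
toUnfinished σ (t ∩ₜ s)    = toUnfinished σ t ∧u toUnfinished σ s
toUnfinished σ (t ∪ₜ s)    = toUnfinished σ t ∨u toUnfinished σ s
toUnfinished σ (t ∖ₜ s)    = toUnfinished σ t ∧u neg (toUnfinished σ s)
toUnfinished σ (nbh d r t) = box d r (toUnfinished σ t)

module _ {G : Graph} {M : ℕ} {σ : ℕ → ℕ} {β β′ : SetAssign G}
         (σ-encodes : ∀ {Y} → Y < M → β′ (σ Y) ≡ β Y) where

  toUnfinished-sound : ∀ t → VarsBelowₜ M t → ∀ v → ⟦ t ⟧ₜ G β v ⇔ ⟦ toUnfinished σ t ⟧u G β′ v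
  toUnfinished-sound (svar X)    X<M         v rewrite σ-encodes X<M = ⇔-refl
  toUnfinished-sound (rel P)     _           v = ⇔-refl
  toUnfinished-sound empty       _           v = mk⇔ (λ ()) λ (P , ¬P) → ¬P P
  toUnfinished-sound (compl t)   t<M         v = ¬-cong-⇔ (toUnfinished-sound t t<M v)
  toUnfinished-sound (t ∩ₜ s)    (t<M , s<M) v = toUnfinished-sound t t<M v ×-⇔ toUnfinished-sound s s<M v
  toUnfinished-sound (t ∪ₜ s)    (t<M , s<M) v =
    ⇔-trans (toUnfinished-sound t t<M v ⊎-⇔ toUnfinished-sound s s<M v) (∨u-sound _ _ v)
  toUnfinished-sound (t ∖ₜ s)    (t<M , s<M) v =
    toUnfinished-sound t t<M v ×-⇔ ¬-cong-⇔ (toUnfinished-sound s s<M v)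
  toUnfinished-sound (nbh d r t) t<M         v = AtLeast-nbh-cong (toUnfinished-sound t t<M)

toUnfinished-below : ∀ {M b} {σ : ℕ → ℕ} → (∀ {Y} → Y < M → σ Y < b) →
                     ∀ t → VarsBelowₜ M t → VarsBelowu b (toUnfinished σ t)
toUnfinished-below σ<b (svar X)    X<M         = σ<b X<M
toUnfinished-below σ<b (rel P)     _           = tt
toUnfinished-below σ<b empty       _           = tt , tt
toUnfinished-below σ<b (compl t)   t<M         = toUnfinished-below σ<b t t<M
toUnfinished-below σ<b (t ∩ₜ s)    (t<M , s<M) = toUnfinished-below σ<b t t<M , toUnfinished-below σ<b s s<M
toUnfinished-below σ<b (t ∪ₜ s)    (t<M , s<M) = toUnfinished-below σ<b t t<M , toUnfinished-below σ<b s s<M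
toUnfinished-below σ<b (t ∖ₜ s)    (t<M , s<M) = toUnfinished-below σ<b t t<M , toUnfinished-below σ<b s s<M
toUnfinished-below σ<b (nbh d r t) t<M         = toUnfinished-below σ<b t t<M

record Naming (k : ℕ) : Set where
  constructor naming
  field
    setName  : ℕ → ℕ
    vertName : Fin k → ℕ
open Naming

bindVert : ∀ {k} → ℕ → Naming k → Naming (suc k)
bindVert X η = naming (setName η) λ { zero → X ; (suc i) → vertName η i }

bindSet : ∀ {k} → ℕ → ℕ → Naming k → Naming k
bindSet Y X η = naming (setName η [ Y ≔ X ]) (vertName η)

record NamesBelow {k : ℕ} (M : ℕ) (η : Naming k) (b : ℕ) : Set where
  field
    setsBelow  : ∀ {Y} → Y < M → setName η Y < b
    vertsBelow : ∀ i → vertName η i < b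
open NamesBelow

record Encodes (G : Graph) {k : ℕ} (M : ℕ) (η : Naming k)
               (β : SetAssign G) (ρ : VertAssign G k) (β′ : SetAssign G) : Set where
  field
    setsEncoded  : ∀ {Y} → Y < M → β′ (setName η Y) ≡ β Y
    vertsEncoded : ∀ i → β′ (vertName η i) ≡ ⁅ ρ i ⁆
open Encodes

module _ {k M : ℕ} {η : Naming k} {b : ℕ} (η<b : NamesBelow M η b) where

  NamesBelow-mono : ∀ {b′} → b ≤ b′ → NamesBelow M η b′
  NamesBelow-mono b≤b′ = record { setsBelow  = λ Y<M → <-≤-trans (setsBelow η<b Y<M) b≤b′
                                ; vertsBelow = λ i → <-≤-trans (vertsBelow η<b i) b≤b′ }

  NamesBelow-bindVert : NamesBelow M (bindVert b η) (suc b)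
  NamesBelow-bindVert = record
    { setsBelow  = setsBelow (NamesBelow-mono (n≤1+n b))
    ; vertsBelow = λ { zero → n<1+n b ; (suc i) → vertsBelow (NamesBelow-mono (n≤1+n b)) i } }

  NamesBelow-bindSet : ∀ X → NamesBelow M (bindSet X b η) (suc b)
  NamesBelow-bindSet X = record { setsBelow = setsBelow′ ; vertsBelow = vertsBelow (NamesBelow-mono (n≤1+n b)) }
    where
    setsBelow′ : ∀ {Y} → Y < M → (setName η [ X ≔ b ]) Y < suc b
    setsBelow′ {Y} Y<M with Y ≟ⁿ X
    ... | yes refl = subst (_< suc b) (sym ([≔]-same (setName η) Y b)) (n<1+n b)
    ... | no Y≢X   = subst (_< suc b) (sym ([≔]-other (setName η) X b Y≢X))
                           (setsBelow (NamesBelow-mono (n≤1+n b)) Y<M)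

  module _ {G : Graph} {β : SetAssign G} {ρ : VertAssign G k} where

    Encodes-agree : ∀ {β′ β″} → Agree b β″ β′ → Encodes G M η β ρ β′ → Encodes G M η β ρ β″
    Encodes-agree β″≈β′ enc = record
      { setsEncoded  = λ Y<M → trans (β″≈β′ (setsBelow η<b Y<M)) (setsEncoded enc Y<M)
      ; vertsEncoded = λ i → trans (β″≈β′ (vertsBelow η<b i)) (vertsEncoded enc i) }

    module _ {β′ : SetAssign G} (enc : Encodes G M η β ρ β′) (S : Subset (n G)) where

      private
        enc′ : Encodes G M η β ρ (update G β′ b S)
        enc′ = Encodes-agree ([≔]-agree β′ S ≤-refl) enc

      Encodes-bindVert : ∀ {v} → S ≡ ⁅ v ⁆ → Encodes G M (bindVert b η) β (extend G v ρ) (update G β′ b S)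
      Encodes-bindVert S≡⁅v⁆ = record
        { setsEncoded  = setsEncoded enc′
        ; vertsEncoded = λ { zero → trans ([≔]-same β′ b S) S≡⁅v⁆ ; (suc i) → vertsEncoded enc′ i } }

      Encodes-bindSet : ∀ X → Encodes G M (bindSet X b η) (update G β X S) ρ (update G β′ b S)
      Encodes-bindSet X = record { setsEncoded = setsEncoded′ ; vertsEncoded = vertsEncoded enc′ }
        where
        setsEncoded′ : ∀ {Y} → Y < M → update G β′ b S ((setName η [ X ≔ b ]) Y) ≡ update G β X S Y
        setsEncoded′ {Y} Y<M with Y ≟ⁿ X
        ... | yes refl = trans (cong (update G β′ b S) ([≔]-same (setName η) Y b))
                               (trans ([≔]-same β′ b S) (sym ([≔]-same β Y S)))
        ... | no Y≢X   = trans (cong (update G β′ b S) ([≔]-other (setName η) X b Y≢X))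
                               (trans (setsEncoded enc′ Y<M) (sym ([≔]-other β X S Y≢X)))

toFinished : ∀ {k} → Naming k → QF k → Finished
toFinished η (edge x y)  = box 1 1 (svar (vertName η y)) at vertName η x
toFinished η (eqv x y)   = svar (vertName η y) at vertName η x
toFinished η (memb x X)  = svar (setName η X) at vertName η x
toFinished η (relv P x)  = rel P at vertName η x
toFinished η (size= t m) = atLeastf (toUnfinished (setName η) t) m ∧f atMostf (toUnfinished (setName η) t) m
toFinished η (size≤ t m) = atMostf (toUnfinished (setName η) t) m
toFinished η (size≥ t m) = atLeastf (toUnfinished (setName η) t) m
toFinished η (teq t s)   = (toUnfinished (setName η) t ⊆f toUnfinished (setName η) s)
                        ∧f (toUnfinished (setName η) s ⊆f toUnfinished (setName η) t)
toFinished η (tsub t s)  = toUnfinished (setName η) t ⊆f toUnfinished (setName η) s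
toFinished η (tsup t s)  = toUnfinished (setName η) s ⊆f toUnfinished (setName η) t
toFinished η (neg φ)     = neg (toFinished η φ)
toFinished η (φ ∧q ψ)    = toFinished η φ ∧f toFinished η ψ
toFinished η (φ ∨q ψ)    = toFinished η φ ∨f toFinished η ψ

module _ {G : Graph} {k M : ℕ} {η : Naming k} {β β′ : SetAssign G} {ρ : VertAssign G k}
         (enc : Encodes G M η β ρ β′) where

  private
    term : ∀ t → VarsBelowₜ M t → ∀ v → ⟦ t ⟧ₜ G β v ⇔ ⟦ toUnfinished (setName η) t ⟧u G β′ v
    term = toUnfinished-sound (setsEncoded enc)

    vert : ∀ i → β′ (vertName η i) ≡ ⁅ ρ i ⁆
    vert = vertsEncoded enc

    subset : ∀ t s → VarsBelowₜ M t → VarsBelowₜ M s →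
             Subseteq G (⟦ t ⟧ₜ G β) (⟦ s ⟧ₜ G β)
               ⇔ ⟦ toUnfinished (setName η) t ⊆f toUnfinished (setName η) s ⟧f G β′
    subset t s t<M s<M = ⇔-trans (Subseteq-cong {G = G} (term t t<M) (term s s<M)) (⊆f-sound {G = G} {β′} _ _)

    open EquationalReasoning {k = equivalence}

  toFinished-sound : ∀ φ → VarsBelowq M φ → ⟦ φ ⟧q G β ρ ⇔ ⟦ toFinished η φ ⟧f G β′
  toFinished-sound (edge x y) _ = begin
    Edge G (ρ x) (ρ y)                                          ∼⟨ ⇔-sym InNbh-one⇔Edge ⟩
    InNbh G 1 (ρ x) (ρ y)                                       ∼⟨ ⇔-sym (∃∈-singletonʳ (vert y)) ⟩
    Σ (V G) (λ w → InNbh G 1 (ρ x) w × w ∈ β′ (vertName η y))  ∼⟨ ⇔-sym (AtLeast-one {G = G}) ⟩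
    ⟦ box 1 1 (svar (vertName η y)) ⟧u G β′ (ρ x)
      ∼⟨ at-sound {G = G} {β′} (box 1 1 (svar (vertName η y))) (vert x) ⟩
    ⟦ toFinished η (edge x y) ⟧f G β′                           ∎
  toFinished-sound (eqv x y) _ = begin
    ρ x ≡ ρ y                          ∼⟨ ⇔-sym x∈⁅y⁆⇔x≡y ⟩
    ρ x ∈ ⁅ ρ y ⁆                      ≡⟨ cong (ρ x ∈_) (vert y) ⟨
    ρ x ∈ β′ (vertName η y)            ∼⟨ at-sound {G = G} {β′} (svar (vertName η y)) (vert x) ⟩
    ⟦ toFinished η (eqv x y) ⟧f G β′   ∎
  toFinished-sound (memb x X) X<M = begin
    ρ x ∈ β X                           ≡⟨ cong (ρ x ∈_) (setsEncoded enc X<M) ⟨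
    ρ x ∈ β′ (setName η X)              ∼⟨ at-sound {G = G} {β′} (svar (setName η X)) (vert x) ⟩
    ⟦ toFinished η (memb x X) ⟧f G β′   ∎
  toFinished-sound (relv P x)  _           = at-sound {G = G} {β′} (rel P) (vert x)
  toFinished-sound (size= t m) t<M         = ⇔-trans (AtLeast-cong {G = G} (term t t<M)) (atLeastf-sound _ m)
                                           ×-⇔ ¬-cong-⇔ (AtLeast-cong {G = G} (term t t<M))
  toFinished-sound (size≤ t m) t<M         = ¬-cong-⇔ (AtLeast-cong {G = G} (term t t<M))
  toFinished-sound (size≥ t m) t<M         = ⇔-trans (AtLeast-cong {G = G} (term t t<M)) (atLeastf-sound _ m)
  toFinished-sound (teq t s)   (t<M , s<M) = subset t s t<M s<M ×-⇔ subset s t s<M t<M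
  toFinished-sound (tsub t s)  (t<M , s<M) = subset t s t<M s<M
  toFinished-sound (tsup t s)  (t<M , s<M) = subset s t s<M t<M
  toFinished-sound (neg φ)     φ<M         = ¬-cong-⇔ (toFinished-sound φ φ<M)
  toFinished-sound (φ ∧q ψ)    (φ<M , ψ<M) = toFinished-sound φ φ<M ×-⇔ toFinished-sound ψ ψ<M
  toFinished-sound (φ ∨q ψ)    (φ<M , ψ<M) =
    ⇔-trans (toFinished-sound φ φ<M ⊎-⇔ toFinished-sound ψ ψ<M) (∨f-sound _ _)

atLeastf-below : ∀ {b} ψ m → VarsBelowu b ψ → VarsBelowf b (atLeastf ψ m)
atLeastf-below ψ zero    _   = tt , tt
atLeastf-below ψ (suc m) ψ<b = ψ<b

module _ {k M b} {η : Naming k} (η<b : NamesBelow M η b) where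

  private
    term : ∀ t → VarsBelowₜ M t → VarsBelowu b (toUnfinished (setName η) t)
    term = toUnfinished-below (setsBelow η<b)

  toFinished-below : ∀ φ → VarsBelowq M φ → VarsBelowf b (toFinished η φ)
  toFinished-below (edge x y)  _           = vertsBelow η<b x , vertsBelow η<b y
  toFinished-below (eqv x y)   _           = vertsBelow η<b x , vertsBelow η<b y
  toFinished-below (memb x X)  X<M         = vertsBelow η<b x , setsBelow η<b X<M
  toFinished-below (relv P x)  _           = vertsBelow η<b x , tt
  toFinished-below (size= t m) t<M         = atLeastf-below _ m (term t t<M) , term t t<M
  toFinished-below (size≤ t m) t<M         = term t t<M
  toFinished-below (size≥ t m) t<M         = atLeastf-below _ m (term t t<M)
  toFinished-below (teq t s)   (t<M , s<M) = (term t t<M , term s s<M) , (term s s<M , term t t<M)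
  toFinished-below (tsub t s)  (t<M , s<M) = term t t<M , term s s<M
  toFinished-below (tsup t s)  (t<M , s<M) = term s s<M , term t t<M
  toFinished-below (neg φ)     φ<M         = toFinished-below φ φ<M
  toFinished-below (φ ∧q ψ)    (φ<M , ψ<M) = toFinished-below φ φ<M , toFinished-below ψ ψ<M
  toFinished-below (φ ∨q ψ)    (φ<M , ψ<M) = toFinished-below φ φ<M , toFinished-below ψ ψ<M

record Prenex : Set where
  constructor prenex
  field
    prefix : List ℕ
    matrix : Finished
    next   : ℕ
open Prenex

⟦_⟧p : Prenex → (G : Graph) → SetAssign G → Set
⟦ p ⟧p G = Exists G (prefix p) (⟦ matrix p ⟧f G)

combine : (Finished → Finished → Finished) → Prenex → (ℕ → Prenex) → Prenex
combine _⊙_ p q = prenex (prefix p ++ prefix (q (next p))) (matrix p ⊙ matrix (q (next p))) (next (q (next p)))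

-- The argument x is the first name not yet in use.
toPrenex : ∀ {k} → DN k → Naming k → ℕ → Prenex
toPrenex (qf φ)   η x = prenex [] (toFinished η φ) x
toPrenex (φ ∧ᵈ ψ) η x = combine _∧f_ (toPrenex φ η x) (toPrenex ψ η)
toPrenex (φ ∨ᵈ ψ) η x = combine _∨f_ (toPrenex φ η x) (toPrenex ψ η)
toPrenex (∃v φ)   η x = let p = toPrenex φ (bindVert x η) (suc x) in
                        prenex (x ∷ prefix p) (isSingleton x ∧f matrix p) (next p)
toPrenex (∃s X φ) η x = let p = toPrenex φ (bindSet X x η) (suc x) in
                        prenex (x ∷ prefix p) (matrix p) (next p)

next-≥ : ∀ {k} (φ : DN k) η x → x ≤ next (toPrenex φ η x)
next-≥ (qf φ)   η x = ≤-refl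
next-≥ (φ ∧ᵈ ψ) η x = ≤-trans (next-≥ φ η x) (next-≥ ψ η _)
next-≥ (φ ∨ᵈ ψ) η x = ≤-trans (next-≥ φ η x) (next-≥ ψ η _)
next-≥ (∃v φ)   η x = ≤-trans (n≤1+n x) (next-≥ φ _ (suc x))
next-≥ (∃s X φ) η x = ≤-trans (n≤1+n x) (next-≥ φ _ (suc x))

prefix-≥ : ∀ {k} (φ : DN k) η x → All (x ≤_) (prefix (toPrenex φ η x))
prefix-≥ (qf φ)   η x = []
prefix-≥ (φ ∧ᵈ ψ) η x = All.++⁺ (prefix-≥ φ η x) (All.map (≤-trans (next-≥ φ η x)) (prefix-≥ ψ η _))
prefix-≥ (φ ∨ᵈ ψ) η x = All.++⁺ (prefix-≥ φ η x) (All.map (≤-trans (next-≥ φ η x)) (prefix-≥ ψ η _))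
prefix-≥ (∃v φ)   η x = ≤-refl ∷ All.map (≤-trans (n≤1+n x)) (prefix-≥ φ _ (suc x))
prefix-≥ (∃s X φ) η x = ≤-refl ∷ All.map (≤-trans (n≤1+n x)) (prefix-≥ φ _ (suc x))

matrix-below : ∀ {k M} (φ : DN k) {η x} → VarsBelowd M φ → NamesBelow M η x →
               ∀ {b} → next (toPrenex φ η x) ≤ b → VarsBelowf b (matrix (toPrenex φ η x))
matrix-below (qf φ) φ<M η<x x≤b = toFinished-below (NamesBelow-mono η<x x≤b) φ φ<M
matrix-below (φ ∧ᵈ ψ) {η} {x} (φ<M , ψ<M) η<x le =
  matrix-below φ φ<M η<x (≤-trans (next-≥ ψ η _) le) ,
  matrix-below ψ ψ<M (NamesBelow-mono η<x (next-≥ φ η x)) le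
matrix-below (φ ∨ᵈ ψ) {η} {x} (φ<M , ψ<M) η<x le =
  matrix-below φ φ<M η<x (≤-trans (next-≥ ψ η _) le) ,
  matrix-below ψ ψ<M (NamesBelow-mono η<x (next-≥ φ η x)) le
matrix-below (∃v φ) {η} {x} φ<M η<x le = (x<b , x<b) , matrix-below φ φ<M (NamesBelow-bindVert η<x) le
  where
  x<b = ≤-trans (next-≥ φ (bindVert x η) (suc x)) le
matrix-below (∃s X φ) φ<M η<x le = matrix-below φ φ<M (NamesBelow-bindSet η<x X) le

∃-vertex⇔∃-singleton : ∀ {m} {D : Fin m → Set} {E : Subset m → Set} → (∀ {S v} → S ≡ ⁅ v ⁆ → D v ⇔ E S) →
                       Σ (Fin m) D ⇔ Σ (Subset m) (λ S → Σ (Fin m) (λ a → S ≡ ⁅ a ⁆) × E S)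
∃-vertex⇔∃-singleton D⇔E = mk⇔ (λ (v , d) → ⁅ v ⁆ , (v , refl) , to (D⇔E refl) d)
                               (λ (S , (a , S≡⁅a⁆) , e) → a , from (D⇔E S≡⁅a⁆) e)

module _ {G : Graph} where

  toPrenex-sound : ∀ {k M} (φ : DN k) → VarsBelowd M φ → ∀ {η x β ρ β′} →
                   NamesBelow M η x → Encodes G M η β ρ β′ → ⟦ φ ⟧d G β ρ ⇔ ⟦ toPrenex φ η x ⟧p G β′
  toPrenex-sound (qf φ) φ<M η<x enc = toFinished-sound enc φ φ<M
  toPrenex-sound (φ ∧ᵈ ψ) (φ<M , ψ<M) {η} {x} η<x enc =
    ⇔-trans (toPrenex-sound φ φ<M η<x enc ×-⇔ ⇔-refl)
            (Exists-++-× (prefix-≥ φ η x) (prefix-≥ ψ η _) (⟦⟧f-local _ (matrix-below φ φ<M η<x ≤-refl))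
                         λ β₁≈ → ⇔-sym (toPrenex-sound ψ ψ<M (NamesBelow-mono η<x (next-≥ φ η x))
                                                                (Encodes-agree η<x β₁≈ enc)))
  toPrenex-sound (φ ∨ᵈ ψ) (φ<M , ψ<M) {η} {x} η<x enc =
    ⇔-trans (toPrenex-sound φ φ<M η<x enc ⊎-⇔ ⇔-refl)
    (⇔-trans (Exists-++-⊎ (prefix-≥ φ η x) (prefix-≥ ψ η _) (⟦⟧f-local _ (matrix-below φ φ<M η<x ≤-refl))
                          λ β₁≈ → ⇔-sym (toPrenex-sound ψ ψ<M (NamesBelow-mono η<x (next-≥ φ η x))
                                                                 (Encodes-agree η<x β₁≈ enc)))
             (Exists-cong (prefix p ++ prefix q) λ β₂ → ∨f-sound {G = G} {β₂} (matrix p) (matrix q)))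
    where
    p = toPrenex φ η x
    q = toPrenex ψ η (next p)
  toPrenex-sound (∃v φ) φ<M {η} {x} {β} {ρ} {β′} η<x enc = begin
    Σ (V G) (λ v → ⟦ φ ⟧d G β (extend G v ρ))
      ∼⟨ ∃-vertex⇔∃-singleton (λ S≡⁅v⁆ →
           toPrenex-sound φ φ<M (NamesBelow-bindVert η<x) (Encodes-bindVert η<x enc _ S≡⁅v⁆)) ⟩
    Σ (Subset (n G)) (λ S → Σ (V G) (λ a → S ≡ ⁅ a ⁆) × Exists G Xs F (update G β′ x S))
      ∼⟨ Σ-⇔ (λ S → isSingleton-sound {G = G} {update G β′ x S} x ([≔]-same β′ x S) ×-⇔ ⇔-refl) ⟩
    Σ (Subset (n G)) (λ S → ⟦ isSingleton x ⟧f G (update G β′ x S) × Exists G Xs F (update G β′ x S))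
      ∼⟨ Σ-⇔ (λ S → ⇔-sym (Exists-×ˡ (prefix-≥ φ (bindVert x η) (suc x))
                                     (⟦⟧f-local {G = G} (isSingleton x) (n<1+n x , n<1+n x)))) ⟩
    ⟦ toPrenex (∃v φ) η x ⟧p G β′ ∎
    where
    open EquationalReasoning {k = equivalence}
    Xs = prefix (toPrenex φ (bindVert x η) (suc x))
    F  = ⟦ matrix (toPrenex φ (bindVert x η) (suc x)) ⟧f G
  toPrenex-sound (∃s X φ) φ<M η<x enc =
    Σ-⇔ λ S → toPrenex-sound φ φ<M (NamesBelow-bindSet η<x X) (Encodes-bindSet η<x enc S X)

close : List ℕ → Finished → EDML
close []       ψ = fin ψ
close (X ∷ Xs) ψ = ∃s X (close Xs ψ)

close-sound : ∀ {G} Xs ψ β → (G ⊨ᵉ close Xs ψ [ β ]) ⇔ Exists G Xs (⟦ ψ ⟧f G) β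
close-sound []       ψ β = ⇔-refl
close-sound {G} (X ∷ Xs) ψ β = Σ-⇔ λ S → close-sound Xs ψ (update G β X S)

initialNaming : Naming 0
initialNaming = naming id λ ()

toEDML : DNSentence → EDML
toEDML φ = close (prefix p) (matrix p)
  where
  p = toPrenex φ initialNaming (proj₁ (VarsBelowd-eventually φ))

toEDML-sound : ∀ φ G β → (G ⊨ᵈ φ [ β ]) ⇔ (G ⊨ᵉ toEDML φ [ β ])
toEDML-sound φ G β =
  ⇔-trans (toPrenex-sound φ (proj₂ (VarsBelowd-eventually φ) ≤-refl) names-below encodes)
          (⇔-sym (close-sound {G} (prefix p) (matrix p) β))
  where
  M = proj₁ (VarsBelowd-eventually φ)
  p = toPrenex φ initialNaming M
  names-below : NamesBelow M initialNaming M
  names-below = record { setsBelow = id ; vertsBelow = λ () }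
  encodes : Encodes G M initialNaming β (noVerts G) β
  encodes = record { setsEncoded = λ _ → refl ; vertsEncoded = λ () }

equivalent : ∀ φ ψ → (∀ G β → (G ⊨ᵈ φ [ β ]) ⇔ (G ⊨ᵉ ψ [ β ])) → Equivalent φ ψ
equivalent _ _ φ⇔ψ G β = to (φ⇔ψ G β) , from (φ⇔ψ G β)

theorem7p3 : ((φ : DNSentence) → Σ EDML (λ ψ → Equivalent φ ψ))
           × ((ψ : EDML) → Σ DNSentence (λ φ → Equivalent φ ψ))
theorem7p3 = (λ φ → toEDML φ , equivalent φ (toEDML φ) (toEDML-sound φ))
           , (λ ψ → toDN ψ , equivalent (toDN ψ) ψ λ G β → toDN-sound {G = G} ψ β (noVerts G))
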